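{- Let $G$ be a unicyclic graph with $\chi_{NL}(G)=k\ge 3$. Then $n(G)\le 2a_1(k)+a_2(k)=\frac12(k^3+k^2-2k)$, where $a_1(k)=k(k-1)$ and $a_2(k)=\frac{k(k-1)(k-2)}{2}$. Moreover, if equality holds, then $G$ has maximum degree $3$ and contains exactly $k(k-1)$ leaves, $\frac{k(k-1)(k-2)}{2}$ vertices of degree $2$, and $k(k-1)$ vertices of degree $3$.
   Context: All graphs are finite, simple, undirected and connected; $n(G)$ is the number of vertices. A unicyclic graph is a connected graph containing exactly one cycle. A $k$-coloring of a graph $G$ is a partition of $V(G)$ into $k$ independent sets (colors). A coloring $\{S_1,\dots,S_k\}$ is neighbor-locating (an NL-coloring) if for any two distinct vertices $u,v$ in the same color class, $\{j: N(u)\cap S_j\neq\emptyset\}\neq\{j: N(v)\cap S_j\neq\emptyset\}$. The neighbor-locating chromatic number $\chi_{NL}(G)$ is the minimum number of colors in an NL-coloring of $G$. -}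

module Defs where

open import Data.Nat using (ℕ; zero; suc; _+_; _*_; _∸_; _/_; _≤_)
open import Data.Nat.Properties using (_≟_)
open import Data.Bool using (Bool; true; false; T; if_then_else_)
open import Data.Fin using (Fin)
open import Data.List using (List; allFin; filter; length; map)
open import Data.Nat.ListAction using (sum)
open import Data.Product using (Σ; ∃; _×_; _,_)
open import Data.Sum using (_⊎_)
open import Data.Empty using (⊥)
open import Relation.Nullary using (¬_)
open import Relation.Binary.PropositionalEquality using (_≡_; _≢_)
open import Function.Bundles using (_⇔_)


record Graph (n : ℕ) : Set where
  field
    adj   : Fin n → Fin n → Bool
    sym   : ∀ u v → adj u v ≡ adj v u
    irrefl : ∀ v → adj v v ≡ false
open Graph public

data Reach {n : ℕ} (E : Fin n → Fin n → Bool) : Fin n → Fin n → Set where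
  here : ∀ {u} → Reach E u u
  step : ∀ {u v w} → T (E u v) → Reach E v w → Reach E u w

Connected : ∀ {n} → Graph n → Set
Connected G = ∀ u v → Reach (adj G) u v

degE : ∀ {n} → (Fin n → Fin n → Bool) → Fin n → ℕ
degE {n} E v = sum (map (λ u → if E v u then 1 else 0) (allFin n))

deg : ∀ {n} → Graph n → Fin n → ℕ
deg G = degE (adj G)

-- A cycle of G, viewed as a subgraph given by its edge set C:
-- C ⊆ E(G), C symmetric, every vertex has C-degree 0 or 2, some vertex
-- has C-degree 2, and any two vertices of C-degree 2 are joined by a
-- walk using C-edges (i.e. C is the edge set of a connected 2-regular
-- subgraph, which in a simple graph is exactly a cycle).
record IsCycle {n : ℕ} (G : Graph n) (C : Fin n → Fin n → Bool) : Set where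
  field
    sub      : ∀ u v → T (C u v) → T (adj G u v)
    symC     : ∀ u v → C u v ≡ C v u
    deg02    : ∀ v → (degE C v ≡ 0) ⊎ (degE C v ≡ 2)
    nonempty : ∃ λ v → degE C v ≡ 2
    conn     : ∀ u v → degE C u ≡ 2 → degE C v ≡ 2 → Reach C u v

Unicyclic : ∀ {n} → Graph n → Set
Unicyclic G = Connected G × (∃ λ C → IsCycle G C × (∀ C′ → IsCycle G C′ → ∀ u v → C′ u v ≡ C u v))

-- Colorings with colour set Fin k; c must be surjective so that the k
-- colour classes form a partition of V(G) into k (nonempty) independent sets.
-- "N(u) meets colour class j"
NbColor : ∀ {n k} → Graph n → (Fin n → Fin k) → Fin n → Fin k → Set
NbColor G c u j = ∃ λ w → T (adj G u w) × c w ≡ j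

record IsNLColoring {n k : ℕ} (G : Graph n) (c : Fin n → Fin k) : Set where
  field
    onto     : ∀ j → ∃ λ v → c v ≡ j
    proper   : ∀ u v → T (adj G u v) → c u ≢ c v
    locating : ∀ u v → u ≢ v → c u ≡ c v →
               ¬ (∀ j → NbColor G c u j ⇔ NbColor G c v j)

HasNLColoring : ∀ {n} → Graph n → ℕ → Set
HasNLColoring {n} G k = ∃ λ (c : Fin n → Fin k) → IsNLColoring G c

χNL≡ : ∀ {n} → Graph n → ℕ → Set
χNL≡ G k = HasNLColoring G k × (∀ k′ → HasNLColoring G k′ → k ≤ k′)

numDeg : ∀ {n} → Graph n → ℕ → ℕ
numDeg {n} G d = length (filter (λ v → deg G v ≟ d) (allFin n))

MaxDegree : ∀ {n} → Graph n → ℕ → Set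
MaxDegree G Δ = (∀ v → deg G v ≤ Δ) × ∃ λ v → deg G v ≡ Δ

a₁ : ℕ → ℕ
a₁ k = k * (k ∸ 1)

a₂ : ℕ → ℕ
a₂ k = (k * (k ∸ 1) * (k ∸ 2)) / 2

module Submission where

-- Write n₁, n₂, n₃₊ for the numbers of vertices of degree 1, 2 and ≥ 3.
-- (1) Degrees. A unicyclic graph has no isolated vertex, and its degrees sum to at most 2n:
--     deleting one edge of its cycle leaves a forest, and a forest with at least one edge
--     has more non-isolated vertices than edges (delete leaf edges one at a time; a
--     nonempty edge set without leaves contains a cycle, traced by a walk that never
--     steps straight back). For positive integers summing to at most 2n this gives
--     n = n₁ + n₂ + n₃₊ and n₃₊ ≤ n₁, with degrees ≤ 3 when n₃₊ = n₁.
-- (2) Colours. In a neighbour-locating colouring with k colours, a vertex of degree 1 or 2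
--     is determined by its colour and the unordered pair of its neighbours' colours (other
--     than its own), so n₁ + n₂ ≤ k·k(k−1)/2 = a₁(k) + a₂(k); for degree 1 the pair is a
--     repeated colour, so n₁ ≤ k(k−1) = a₁(k).

open import Defs renaming (sym to adj-sym)
open import Data.Nat using (ℕ; zero; suc; _+_; _*_; _∸_; _^_; _/_; _≤_; _<_; z≤n; s≤s; _≤ᵇ_; _≡ᵇ_; _<ᵇ_)
open import Data.Nat.Properties
open import Data.Nat.Tactic.RingSolver using (solve-∀)
open import Data.Nat.DivMod using (m*n/n≡m)
open import Data.Nat.Induction using (<-wellFounded)
open import Induction.WellFounded using (Acc; acc)
open import Relation.Binary.Definitions using (tri<; tri≈; tri>)
open import Data.Bool using (Bool; true; false; T; if_then_else_; _∧_; _∨_; not)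
open import Data.Bool.Properties using (T-∧; T-∨; T-≡; ∧-comm; ∨-comm; ∧-zeroʳ; ∧-identityʳ)
open import Data.Fin using (Fin; zero; suc; punchIn; punchOut; toℕ)
import Data.Fin.Properties as Finₚ
open import Data.List using (allFin; filter; length; map; tabulate)
open import Data.Nat.ListAction using () renaming (sum to sumList)
open import Algebra.Properties.Semiring.Sum +-*-semiring using (sum; sum-syntax; sum-cong-≗; ∑-distrib-+; ∑-comm; sum-replicate-zero)
open import Data.Product using (Σ; ∃; _×_; _,_; proj₁; proj₂)
open import Data.Sum using (_⊎_; inj₁; inj₂; swap)
open import Data.Empty using (⊥; ⊥-elim)
open import Data.Unit using (tt)
open import Relation.Nullary using (¬_; Dec; yes; no; does)
open import Relation.Nullary.Decidable using (dec-true; dec-false; toWitness; fromWitness; T?; ⌊_⌋)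
open import Relation.Binary.PropositionalEquality using (_≡_; _≢_; refl; sym; trans; cong; cong₂; subst; subst₂; module ≡-Reasoning)
open import Function using (_∘_; _⇔_; mk⇔; Equivalence)
open Equivalence using (to; from)

ind : Bool → ℕ
ind b = if b then 1 else 0

count : ∀ {n} → (Fin n → Bool) → ℕ
count {n} p = ∑[ i < n ] ind (p i)

_==_ : ∀ {n} → Fin n → Fin n → Bool
a == b = does (a Finₚ.≟ b)

==-refl : ∀ {n} (a : Fin n) → (a == a) ≡ true
==-refl a = dec-true (a Finₚ.≟ a) refl

==-≢ : ∀ {n} {a b : Fin n} → a ≢ b → (a == b) ≡ false
==-≢ {a = a} {b} = dec-false (a Finₚ.≟ b)

T-==-refl : ∀ {n} (a : Fin n) → T (a == a)
T-==-refl a = from T-≡ (==-refl a)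

==⇒≡ : ∀ {n} {a b : Fin n} → T (a == b) → a ≡ b
==⇒≡ {a = a} {b} t with a Finₚ.≟ b
... | yes a≡b = a≡b

T-ext : ∀ {b c} → (T b → T c) → (T c → T b) → b ≡ c
T-ext {true} {true} _ _ = refl
T-ext {true} {false} f _ = ⊥-elim (f tt)
T-ext {false} {true} _ g = ⊥-elim (g tt)
T-ext {false} {false} _ _ = refl

¬T⇒false : ∀ {b} → ¬ T b → b ≡ false
¬T⇒false {true} h = ⊥-elim (h tt)
¬T⇒false {false} h = refl

ind≤1 : ∀ b → ind b ≤ 1
ind≤1 true = ≤-refl
ind≤1 false = z≤n

sumList-allFin : ∀ n (g : Fin n → ℕ) → sumList (map g (allFin n)) ≡ ∑[ i < n ] g i
sumList-allFin n g = go n (λ i → i)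
  where
  go : ∀ m (h : Fin m → Fin n) → sumList (map g (tabulate h)) ≡ ∑[ i < m ] g (h i)
  go zero h = refl
  go (suc m) h = cong (g (h zero) +_) (go m (h ∘ suc))

degE≡count : ∀ {n} (E : Fin n → Fin n → Bool) v → degE E v ≡ count (E v)
degE≡count {n} E v = sumList-allFin n (λ u → ind (E v u))

sum-mono : ∀ {n} {f g : Fin n → ℕ} → (∀ i → f i ≤ g i) → sum f ≤ sum g
sum-mono {zero} h = z≤n
sum-mono {suc n} h = +-mono-≤ (h zero) (sum-mono (h ∘ suc))

sum-mono-< : ∀ {n} {f g : Fin n → ℕ} (x : Fin n) → (∀ i → f i ≤ g i) → f x < g x → sum f < sum g
sum-mono-< {suc n} zero h hx = +-mono-<-≤ hx (sum-mono (h ∘ suc))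
sum-mono-< {suc n} (suc x) h hx = +-mono-≤-< (h zero) (sum-mono-< x (h ∘ suc) hx)

sum-const : ∀ n c → ∑[ i < n ] c ≡ n * c
sum-const zero c = refl
sum-const (suc n) c = cong (c +_) (sum-const n c)

sum-point : ∀ {n} (x : Fin n) (g : Fin n → ℕ) → ∑[ i < n ] (ind (x == i) * g i) ≡ g x
sum-point {suc n} zero g = trans (cong₂ _+_ (+-identityʳ (g zero)) (sum-replicate-zero n)) (+-identityʳ _)
sum-point {suc n} (suc x) g = sum-point x (g ∘ suc)

sum-single : ∀ {n} (x : Fin n) → ∑[ i < n ] ind (x == i) ≡ 1
sum-single x = trans (sum-cong-≗ (λ i → sym (*-identityʳ (ind (x == i))))) (sum-point x (λ _ → 1))

count-cong : ∀ {n} {p q : Fin n → Bool} → (∀ u → p u ≡ q u) → count p ≡ count q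
count-cong h = sum-cong-≗ (cong ind ∘ h)

count-none : ∀ {n} (p : Fin n → Bool) → (∀ u → ¬ T (p u)) → count p ≡ 0
count-none {n} p h = trans (count-cong (¬T⇒false ∘ h)) (sum-replicate-zero n)

count≤ : ∀ {n} (p : Fin n → Bool) → count p ≤ n
count≤ {n} p = ≤-trans (sum-mono (ind≤1 ∘ p)) (≤-reflexive (trans (sum-const n 1) (*-identityʳ n)))

count-split : ∀ {n} (p : Fin n → Bool) (x : Fin n) → count p ≡ ind (p x) + count (λ u → p u ∧ not (u == x))
count-split {n} p x = trans (sum-cong-≗ piece)
  (trans (∑-distrib-+ (λ u → ind (x == u) * ind (p x)) (λ u → ind (p u ∧ not (u == x)))) (cong (_+ count (λ u → p u ∧ not (u == x))) (sum-point x (λ _ → ind (p x)))))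
  where
  piece : ∀ u → ind (p u) ≡ ind (x == u) * ind (p x) + ind (p u ∧ not (u == x))
  piece u with x Finₚ.≟ u
  ... | yes refl rewrite ==-refl x with p x
  ...   | true = refl
  ...   | false = refl
  piece u | no x≢u rewrite ==-≢ (x≢u ∘ sym) with p u
  ...   | true = refl
  ...   | false = refl

count-witness : ∀ {n} (p : Fin n → Bool) → 1 ≤ count p → ∃ λ u → T (p u)
count-witness p 1≤ with Finₚ.any? (λ u → T? (p u))
... | yes found = found
... | no none = ⊥-elim (1+n≰n (≤-trans 1≤ (≤-reflexive (count-none p (λ u pu → none (u , pu))))))

count-≥1 : ∀ {n} (p : Fin n → Bool) (x : Fin n) → T (p x) → 1 ≤ count p
count-≥1 p x px rewrite count-split p x | to T-≡ px = s≤s z≤n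

count-mono : ∀ {n} {p q : Fin n → Bool} → (∀ u → T (p u) → T (q u)) → count p ≤ count q
count-mono p⇒q = sum-mono (λ u → ind-mono (p⇒q u))
  where
  ind-mono : ∀ {b c} → (T b → T c) → ind b ≤ ind c
  ind-mono {false} _ = z≤n
  ind-mono {true} {true} _ = ≤-refl
  ind-mono {true} {false} b⇒c = ⊥-elim (b⇒c tt)

count-≥2 : ∀ {n} (p : Fin n → Bool) {x y : Fin n} → x ≢ y → T (p x) → T (p y) → 2 ≤ count p
count-≥2 p {x} {y} x≢y px py rewrite count-split p x | to T-≡ px =
  s≤s (count-≥1 (λ u → p u ∧ not (u == x)) y (from T-∧ (py , subst (T ∘ not) (sym (==-≢ (x≢y ∘ sym))) tt)))

count-pair : ∀ {n} {a b : Fin n} → a ≢ b → count (λ y → a == y ∨ b == y) ≡ 2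
count-pair {n} {a} {b} a≢b = trans (count-split _ a)
  (cong₂ _+_ (cong (λ e → ind (e ∨ b == a)) (==-refl a)) (trans (count-cong only-b) (sum-single b)))
  where
  only-b : ∀ y → ((a == y ∨ b == y) ∧ not (y == a)) ≡ (b == y)
  only-b y with y Finₚ.≟ a
  ... | yes refl rewrite ==-refl y | ==-≢ (a≢b ∘ sym) = refl
  ... | no y≢a rewrite ==-≢ (y≢a ∘ sym) = ∧-identityʳ (b == y)

count-∨ : ∀ {n} (p q : Fin n → Bool) → (∀ u → T (p u) → ¬ T (q u)) → count (λ u → p u ∨ q u) ≡ count p + count q
count-∨ p q disjoint = trans (sum-cong-≗ piece) (∑-distrib-+ (ind ∘ p) (ind ∘ q))
  where
  piece : ∀ u → ind (p u ∨ q u) ≡ ind (p u) + ind (q u)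
  piece u with p u in pu | q u in qu
  ... | true | true = ⊥-elim (disjoint u (from T-≡ pu) (from T-≡ qu))
  ... | true | false = refl
  ... | false | _ = refl

sum-fibre : ∀ {m} b (x : Fin m) → ∑[ j < m ] ind (b ∧ (x == j)) ≡ ind b
sum-fibre {m} false x = sum-replicate-zero m
sum-fibre true x = sum-single x

count-by-key : ∀ {n m} (p : Fin n → Bool) (key : Fin n → Fin m) →
  count p ≡ ∑[ j < m ] count (λ u → p u ∧ (key u == j))
count-by-key p key =
  trans (sum-cong-≗ (λ u → sym (sum-fibre (p u) (key u))))
        (∑-comm (λ u j → ind (p u ∧ (key u == j))))

count-subsingleton : ∀ {n} (p : Fin n → Bool) (q : Bool) → (∀ u → T (p u) → T q) →
  (∀ u v → T (p u) → T (p v) → u ≡ v) → count p ≤ ind q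
count-subsingleton p q p⇒q unique with Finₚ.any? (λ u → T? (p u))
... | no none = ≤-trans (≤-reflexive (count-none p (λ u pu → none (u , pu)))) z≤n
... | yes (v , pv) = begin
  count p                                          ≡⟨ count-split p v ⟩
  ind (p v) + count (λ u → p u ∧ not (u == v))     ≡⟨ cong₂ _+_ (cong ind (to T-≡ pv)) (count-none _ others) ⟩
  1                                                ≡⟨ cong ind (sym (to T-≡ (p⇒q v pv))) ⟩
  ind q                                            ∎
  where
  open ≤-Reasoning
  others : ∀ u → ¬ T (p u ∧ not (u == v))
  others u t with to T-∧ t
  ... | pu , u≢v rewrite unique u v pu pv | ==-refl v = u≢v

EdgeSet : ℕ → Set
EdgeSet n = Fin n → Fin n → Bool

IsSymmetric : ∀ {n} → EdgeSet n → Set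
IsSymmetric E = ∀ x y → E x y ≡ E y x

IsIrreflexive : ∀ {n} → EdgeSet n → Set
IsIrreflexive E = ∀ x → E x x ≡ false

_⊆_ : ∀ {n} → EdgeSet n → EdgeSet n → Set
E ⊆ F = ∀ x y → T (E x y) → T (F x y)

degreeSum : ∀ {n} → EdgeSet n → ℕ
degreeSum {n} E = ∑[ v < n ] count (E v)

support : ∀ {n} → EdgeSet n → ℕ
support E = count (λ v → 0 <ᵇ count (E v))

deleteEdge : ∀ {n} → EdgeSet n → Fin n → Fin n → EdgeSet n
deleteEdge E a b x y = E x y ∧ not ((a == x ∧ b == y) ∨ (b == x ∧ a == y))

module _ {n} (E : EdgeSet n) (a b : Fin n) where

  deleteEdge-sym : IsSymmetric E → IsSymmetric (deleteEdge E a b)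
  deleteEdge-sym E-sym x y rewrite E-sym x y | ∧-comm (a == x) (b == y) | ∧-comm (b == x) (a == y)
    | ∨-comm (b == y ∧ a == x) (a == y ∧ b == x) = refl

  deleteEdge-irrefl : IsIrreflexive E → IsIrreflexive (deleteEdge E a b)
  deleteEdge-irrefl E-irr x rewrite E-irr x = refl

  deleteEdge-⊆ : deleteEdge E a b ⊆ E
  deleteEdge-⊆ x y t = proj₁ (to T-∧ t)

  deleteEdge-removes : deleteEdge E a b a b ≡ false
  deleteEdge-removes rewrite ==-refl a | ==-refl b = ∧-zeroʳ (E a b)

  module _ (E-sym : IsSymmetric E) (ab : T (E a b)) (a≢b : a ≢ b) where

    deleteEdge-degree : ∀ x → count (E x) ≡ count (deleteEdge E a b x) + (ind (a == x) + ind (b == x))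
    deleteEdge-degree x = begin
      count (E x)                                            ≡⟨ sum-cong-≗ pointwise ⟩
      ∑[ y < n ] (ind (deleteEdge E a b x y) + (ind (a == x ∧ b == y) + ind (b == x ∧ a == y)))
        ≡⟨ ∑-distrib-+ (λ y → ind (deleteEdge E a b x y)) _ ⟩
      count (deleteEdge E a b x) + ∑[ y < n ] (ind (a == x ∧ b == y) + ind (b == x ∧ a == y))
        ≡⟨ cong (count (deleteEdge E a b x) +_) (trans (∑-distrib-+ (λ y → ind (a == x ∧ b == y)) _)
             (cong₂ _+_ (sum-fibre (a == x) b) (sum-fibre (b == x) a))) ⟩
      count (deleteEdge E a b x) + (ind (a == x) + ind (b == x)) ∎
      where
      open ≡-Reasoning
      removed : ∀ {e} → T e → ind e ≡ ind (e ∧ false) + 1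
      removed {true} _ = refl
      both : ∀ c d e f → (c == d ∧ e == f) ≡ true → c ≡ d × e ≡ f
      both c d e f eq with to (T-∧ {c == d} {e == f}) (from T-≡ eq)
      ... | c≡d , e≡f = ==⇒≡ c≡d , ==⇒≡ e≡f
      pointwise : ∀ y → ind (E x y) ≡ ind (deleteEdge E a b x y) + (ind (a == x ∧ b == y) + ind (b == x ∧ a == y))
      pointwise y with a == x ∧ b == y in forward | b == x ∧ a == y in backward
      ... | true | true = ⊥-elim (a≢b (trans (proj₁ (both a x b y forward)) (sym (proj₁ (both b x a y backward)))))
      ... | true | false = removed (subst₂ (λ u v → T (E u v)) (proj₁ (both a x b y forward)) (proj₂ (both a x b y forward)) ab)
      ... | false | true = removed (subst₂ (λ u v → T (E u v)) (proj₁ (both b x a y backward)) (proj₂ (both b x a y backward))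
                                            (subst T (E-sym a b) ab))
      ... | false | false with E x y
      ...   | true = refl
      ...   | false = refl

    deleteEdge-degreeSum : degreeSum E ≡ degreeSum (deleteEdge E a b) + 2
    deleteEdge-degreeSum =
      trans (sum-cong-≗ deleteEdge-degree)
      (trans (∑-distrib-+ (λ x → count (deleteEdge E a b x)) _)
      (cong (degreeSum (deleteEdge E a b) +_) (trans (∑-distrib-+ (λ x → ind (a == x)) _) (cong₂ _+_ (sum-single a) (sum-single b)))))

Reach-++ : ∀ {n} {E : EdgeSet n} {u v w} → Reach E u v → Reach E v w → Reach E u w
Reach-++ here r = r
Reach-++ (step e r) r′ = step e (Reach-++ r r′)

-- A closed walk W 0, W 1, …, W L = W 0 (L = suc ℓ) in E ⊆ G through L ≥ 3 distinct
-- vertices that never steps straight back traces a cycle of G, consisting of its steps.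
module ClosedWalk {n} (G : Graph n) (E : EdgeSet n) (E-sym : IsSymmetric E) (E⊆G : E ⊆ adj G)
  (W : ℕ → Fin n) (ℓ : ℕ) (2≤ℓ : 2 ≤ ℓ)
  (steps : ∀ t → T (E (W t) (W (suc t))))
  (nonBacktracking : ∀ t → W (suc (suc t)) ≢ W t)
  (closed : W (suc ℓ) ≡ W 0)
  (distinct : ∀ p q → p < suc ℓ → q < suc ℓ → W p ≡ W q → p ≡ q) where

  L : ℕ
  L = suc ℓ

  stepPair : ℕ → Fin n → Fin n → Bool
  stepPair t x y = (W t == x ∧ W (suc t) == y) ∨ (W t == y ∧ W (suc t) == x)

  cycleEdges : EdgeSet n
  cycleEdges x y = ⌊ anyUpTo? (λ t → T? (stepPair t x y)) L ⌋

  cycleEdges-intro : ∀ {t x y} → t < L → T (stepPair t x y) → T (cycleEdges x y)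
  cycleEdges-intro t<L s = fromWitness (_ , t<L , s)

  cycleEdges-elim : ∀ {x y} → T (cycleEdges x y) → ∃ λ t → t < L × T (stepPair t x y)
  cycleEdges-elim = toWitness

  forwardStep : ∀ t → T (stepPair t (W t) (W (suc t)))
  forwardStep t = from T-∨ (inj₁ (from T-∧ (T-==-refl (W t) , T-==-refl (W (suc t)))))

  backwardStep : ∀ t → T (stepPair t (W (suc t)) (W t))
  backwardStep t = from T-∨ (inj₂ (from T-∧ (T-==-refl (W t) , T-==-refl (W (suc t)))))

  stepPair-edge : ∀ t x y → T (stepPair t x y) → T (E x y)
  stepPair-edge t x y s with to T-∨ s
  ... | inj₁ fwd with to T-∧ fwd
  ...   | p , q = subst₂ (λ u v → T (E u v)) (==⇒≡ p) (==⇒≡ q) (steps t)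
  stepPair-edge t x y s | inj₂ bwd with to T-∧ bwd
  ...   | p , q = subst₂ (λ u v → T (E u v)) (==⇒≡ q) (==⇒≡ p) (subst T (E-sym (W t) (W (suc t))) (steps t))

  cycleEdges-⊆E : cycleEdges ⊆ E
  cycleEdges-⊆E x y c with cycleEdges-elim c
  ... | t , _ , s = stepPair-edge t x y s

  cycleEdges-sym : IsSymmetric cycleEdges
  cycleEdges-sym x y = T-ext (flip x y) (flip y x)
    where
    flip : ∀ x y → T (cycleEdges x y) → T (cycleEdges y x)
    flip x y c with cycleEdges-elim c
    ... | t , t<L , s = cycleEdges-intro t<L (subst T (∨-comm (W t == x ∧ W (suc t) == y) _) s)

  next prev : ℕ → Fin n
  next a = W (suc a)
  prev zero = W ℓ
  prev (suc a) = W a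

  neighbours⇒ : ∀ {a y} → a < L → T (cycleEdges (W a) y) → y ≡ next a ⊎ y ≡ prev a
  neighbours⇒ {a} {y} a<L c with cycleEdges-elim c
  ... | t , t<L , s with to T-∨ s
  ...   | inj₁ fwd with to T-∧ fwd
  ...     | Wt≡Wa , Wt+1≡y with distinct t a t<L a<L (==⇒≡ Wt≡Wa)
  ...       | refl = inj₁ (sym (==⇒≡ Wt+1≡y))
  neighbours⇒ {a} {y} a<L c | t , t<L , s | inj₂ bwd with to T-∧ bwd
  ...     | Wt≡y , Wt+1≡Wa with m<1+n⇒m<n∨m≡n (s≤s t<L)
  ...       | inj₁ t+1<L with distinct (suc t) a t+1<L a<L (==⇒≡ Wt+1≡Wa)
  ...         | refl = inj₂ (sym (==⇒≡ Wt≡y))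
  neighbours⇒ {a} {y} a<L c | t , t<L , s | inj₂ bwd | Wt≡y , Wt+1≡Wa | inj₂ refl
    with distinct 0 a (s≤s z≤n) a<L (trans (sym closed) (==⇒≡ Wt+1≡Wa))
  ...         | refl = inj₂ (sym (==⇒≡ Wt≡y))

  neighbours⇐ : ∀ {a y} → a < L → y ≡ next a ⊎ y ≡ prev a → T (cycleEdges (W a) y)
  neighbours⇐ {a} a<L (inj₁ refl) = cycleEdges-intro a<L (forwardStep a)
  neighbours⇐ {suc a} a<L (inj₂ refl) = cycleEdges-intro (<-trans (n<1+n a) a<L) (backwardStep a)
  neighbours⇐ {zero} a<L (inj₂ refl) = subst (λ z → T (cycleEdges z (W ℓ))) closed (cycleEdges-intro (n<1+n ℓ) (backwardStep ℓ))

  next≢prev : ∀ {a} → a < L → next a ≢ prev a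
  next≢prev {suc a} a<L = nonBacktracking a
  next≢prev {zero} a<L eq with distinct 1 ℓ (≤-trans (s≤s (s≤s z≤n)) (s≤s 2≤ℓ)) (n<1+n ℓ) eq
  ... | refl = <-irrefl refl 2≤ℓ

  degree-on : ∀ {a} → a < L → count (cycleEdges (W a)) ≡ 2
  degree-on {a} a<L = trans (count-cong same) (count-pair (next≢prev a<L))
    where
    same : ∀ y → cycleEdges (W a) y ≡ (next a == y ∨ prev a == y)
    same y = T-ext (λ c → fwd (neighbours⇒ a<L c)) (λ e → neighbours⇐ a<L (bwd (to T-∨ e)))
      where
      fwd : y ≡ next a ⊎ y ≡ prev a → T (next a == y ∨ prev a == y)
      fwd (inj₁ refl) = from T-∨ (inj₁ (T-==-refl y))
      fwd (inj₂ refl) = from T-∨ (inj₂ (T-==-refl y))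
      bwd : T (next a == y) ⊎ T (prev a == y) → y ≡ next a ⊎ y ≡ prev a
      bwd (inj₁ e) = inj₁ (sym (==⇒≡ e))
      bwd (inj₂ e) = inj₂ (sym (==⇒≡ e))

  degree-off : ∀ {x} → ¬ (∃ λ a → a < L × W a ≡ x) → ∀ y → ¬ T (cycleEdges x y)
  degree-off {x} off y c with cycleEdges-elim c
  ... | t , t<L , s with to T-∨ s
  ...   | inj₁ fwd = off (t , t<L , ==⇒≡ (proj₁ (to T-∧ fwd)))
  ...   | inj₂ bwd with m<1+n⇒m<n∨m≡n (s≤s t<L)
  ...     | inj₁ t+1<L = off (suc t , t+1<L , ==⇒≡ (proj₂ (to (T-∧ {W t == y}) bwd)))
  ...     | inj₂ refl = off (0 , s≤s z≤n , trans (sym closed) (==⇒≡ (proj₂ (to (T-∧ {W t == y}) bwd))))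

  onWalk? : ∀ x → Dec (∃ λ a → a < L × W a ≡ x)
  onWalk? x = anyUpTo? (λ a → W a Finₚ.≟ x) L

  reach-end : ∀ d a → a + d ≡ L → Reach cycleEdges (W a) (W L)
  reach-end zero a eq = subst (λ z → Reach cycleEdges (W a) (W z)) (trans (sym (+-identityʳ a)) eq) here
  reach-end (suc d) a eq =
    step (cycleEdges-intro (subst (a <_) eq (m<m+n a (s≤s z≤n))) (forwardStep a)) (reach-end d (suc a) (trans (sym (+-suc a d)) eq))

  reach-start : ∀ b → b ≤ L → Reach cycleEdges (W 0) (W b)
  reach-start zero _ = here
  reach-start (suc b) b<L = Reach-++ (reach-start b (<⇒≤ b<L)) (step (cycleEdges-intro b<L (forwardStep b)) here)

  isCycle : IsCycle G cycleEdges
  isCycle = record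
    { sub = λ x y c → E⊆G x y (cycleEdges-⊆E x y c)
    ; symC = cycleEdges-sym
    ; deg02 = deg02
    ; nonempty = W 0 , trans (degE≡count cycleEdges (W 0)) (degree-on (s≤s z≤n))
    ; conn = conn
    }
    where
    deg02 : ∀ v → (degE cycleEdges v ≡ 0) ⊎ (degE cycleEdges v ≡ 2)
    deg02 v with onWalk? v
    ... | yes (a , a<L , refl) = inj₂ (trans (degE≡count cycleEdges (W a)) (degree-on a<L))
    ... | no off = inj₁ (trans (degE≡count cycleEdges v) (count-none _ (degree-off off)))
    onWalk : ∀ u → degE cycleEdges u ≡ 2 → ∃ λ a → a < L × W a ≡ u
    onWalk u d with onWalk? u
    ... | yes on = on
    ... | no off with trans (sym d) (trans (degE≡count cycleEdges u) (count-none _ (degree-off off)))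
    ...   | ()
    conn : ∀ u v → degE cycleEdges u ≡ 2 → degE cycleEdges v ≡ 2 → Reach cycleEdges u v
    conn u v du dv with onWalk u du | onWalk v dv
    ... | a , a<L , refl | b , b<L , refl =
      Reach-++ (reach-end (L ∸ a) a (m+[n∸m]≡n (<⇒≤ a<L))) (subst (λ z → Reach cycleEdges z (W b)) (sym closed) (reach-start b (<⇒≤ b<L)))

leastWitness : ∀ {P : ℕ → Set} → (∀ b → Dec (P b)) → ∀ b → P b → ∃ λ m → P m × (∀ m′ → m′ < m → ¬ P m′)
leastWitness {P} P? b Pb = go b Pb (<-wellFounded b)
  where
  go : ∀ b → P b → Acc _<_ b → ∃ λ m → P m × (∀ m′ → m′ < m → ¬ P m′)
  go b Pb (acc smaller) with anyUpTo? P? b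
  ... | no none = b , Pb , λ m′ m′<b Pm′ → none (m′ , m′<b , Pm′)
  ... | yes (b′ , b′<b , Pb′) = go b′ Pb′ (smaller b′<b)

-- In an edge set without vertices of degree 1, a walk along an edge can always continue
-- without stepping straight back. Following such a walk from an edge v₀u₀ until a vertex
-- repeats for the first time closes a cycle.
module NonBacktrackingWalk {n} (G : Graph n) (E : EdgeSet n) (E-sym : IsSymmetric E) (E-irr : IsIrreflexive E)
  (E⊆G : E ⊆ adj G) (no-leaf : ∀ v → count (E v) ≢ 1) (v₀ u₀ : Fin n) (v₀u₀ : T (E v₀ u₀)) where

  onward : ∀ p c → T (E c p) → ∃ λ u → T (E c u) × u ≢ p
  onward p c cp with Finₚ.any? (λ u → T? (E c u ∧ not (u == p)))
  ... | yes (u , t) with to T-∧ t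
  ...   | cu , u≢p = u , cu , λ { refl → subst (T ∘ not) (==-refl u) u≢p }
  onward p c cp | no none =
    ⊥-elim (no-leaf c (trans (count-split (E c) p) (cong₂ _+_ (cong ind (to T-≡ cp)) (count-none _ (λ u t → none (u , t))))))

  Arc : Set
  Arc = Σ (Fin n × Fin n) λ pc → T (E (proj₁ pc) (proj₂ pc))

  advance : Arc → Arc
  advance ((p , c) , pc) = (c , proj₁ next) , proj₁ (proj₂ next)
    where
    next : ∃ λ u → T (E c u) × u ≢ p
    next = onward p c (subst T (E-sym p c) pc)

  arc : ℕ → Arc
  arc zero = (v₀ , u₀) , v₀u₀
  arc (suc t) = advance (arc t)

  w : ℕ → Fin n
  w t = proj₁ (proj₁ (arc t))

  w-step : ∀ t → T (E (w t) (w (suc t)))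
  w-step t = proj₂ (arc t)

  w-nonBacktracking : ∀ t → w (suc (suc t)) ≢ w t
  w-nonBacktracking t = proj₂ (proj₂ (onward (w t) (w (suc t)) (subst T (E-sym _ _) (w-step t))))

  Repeats : ℕ → Set
  Repeats b = ∃ λ a → a < b × w a ≡ w b

  repeats? : ∀ b → Dec (Repeats b)
  repeats? b = anyUpTo? (λ a → w a Finₚ.≟ w b) b

  someRepetition : ∃ λ b → Repeats b
  someRepetition with Finₚ.pigeonhole (n<1+n n) (λ j → w (toℕ j))
  ... | i , j , i<j , wi≡wj = toℕ j , toℕ i , i<j , wi≡wj

  firstRepetition : ∃ λ b → Repeats b × (∀ b′ → b′ < b → ¬ Repeats b′)
  firstRepetition = leastWitness repeats? (proj₁ someRepetition) (proj₂ someRepetition)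

  b a : ℕ
  b = proj₁ firstRepetition
  a = proj₁ (proj₁ (proj₂ firstRepetition))

  a<b : a < b
  a<b = proj₁ (proj₂ (proj₁ (proj₂ firstRepetition)))

  wa≡wb : w a ≡ w b
  wa≡wb = proj₂ (proj₂ (proj₁ (proj₂ firstRepetition)))

  noEarlierRepetition : ∀ b′ → b′ < b → ¬ Repeats b′
  noEarlierRepetition = proj₂ (proj₂ firstRepetition)

  ℓ : ℕ
  ℓ = b ∸ suc a

  W : ℕ → Fin n
  W t = w (a + t)

  a+ℓ+1≡b : a + suc ℓ ≡ b
  a+ℓ+1≡b = trans (+-suc a ℓ) (m+[n∸m]≡n a<b)

  closed : W (suc ℓ) ≡ W 0
  closed = trans (cong w a+ℓ+1≡b) (trans (sym wa≡wb) (cong w (sym (+-identityʳ a))))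

  W-step : ∀ t → T (E (W t) (W (suc t)))
  W-step t = subst (λ z → T (E (W t) (w z))) (sym (+-suc a t)) (w-step (a + t))

  W-nonBacktracking : ∀ t → W (suc (suc t)) ≢ W t
  W-nonBacktracking t eq = w-nonBacktracking (a + t) (trans (cong w (sym (trans (+-suc a (suc t)) (cong suc (+-suc a t))))) eq)

  below : ∀ {r} → r < suc ℓ → a + r < b
  below {r} r<L = subst (a + r <_) a+ℓ+1≡b (+-monoʳ-< a r<L)

  -- By minimality of b, the vertices W 0, …, W ℓ are distinct.
  distinct : ∀ p q → p < suc ℓ → q < suc ℓ → W p ≡ W q → p ≡ q
  distinct p q p<L q<L eq with <-cmp p q
  ... | tri< p<q _ _ = ⊥-elim (noEarlierRepetition (a + q) (below q<L) (a + p , +-monoʳ-< a p<q , eq))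
  ... | tri≈ _ p≡q _ = p≡q
  ... | tri> _ _ q<p = ⊥-elim (noEarlierRepetition (a + p) (below p<L) (a + q , +-monoʳ-< a q<p , sym eq))

  -- Loops and immediate returns are excluded, so the cycle has length at least 3.
  2≤ℓ : 2 ≤ ℓ
  2≤ℓ with ℓ in ℓ-eq
  ... | zero = ⊥-elim (subst T (E-irr (W 0))
                (subst (λ z → T (E (W 0) z)) (trans (cong (W ∘ suc) (sym ℓ-eq)) closed) (W-step 0)))
  ... | suc zero = ⊥-elim (W-nonBacktracking 0 (trans (cong (W ∘ suc) (sym ℓ-eq)) closed))
  ... | suc (suc _) = s≤s (s≤s z≤n)

  open ClosedWalk G E E-sym E⊆G W ℓ 2≤ℓ W-step W-nonBacktracking closed distinct public

leafless⇒cycle : ∀ {n} (G : Graph n) (E : EdgeSet n) → IsSymmetric E → IsIrreflexive E → E ⊆ adj G →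
  (∀ v → count (E v) ≢ 1) → ∀ {v₀ u₀} → T (E v₀ u₀) → ∃ λ C → IsCycle G C × C ⊆ E
leafless⇒cycle G E E-sym E-irr E⊆G no-leaf {v₀} {u₀} v₀u₀ = cycleEdges , isCycle , cycleEdges-⊆E
  where open NonBacktrackingWalk G E E-sym E-irr E⊆G no-leaf v₀ u₀ v₀u₀

record IsForest {n} (G : Graph n) (F : EdgeSet n) : Set where
  field
    symmetric   : IsSymmetric F
    irreflexive : IsIrreflexive F
    inG         : F ⊆ adj G
    acyclic     : ∀ C → IsCycle G C → C ⊆ F → ⊥

module _ {n} {G : Graph n} where

  deleteEdge-forest : ∀ {F} a b → IsForest G F → IsForest G (deleteEdge F a b)
  deleteEdge-forest {F} a b forest = record
    { symmetric = deleteEdge-sym F a b symmetric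
    ; irreflexive = deleteEdge-irrefl F a b irreflexive
    ; inG = λ x y e → inG x y (deleteEdge-⊆ F a b x y e)
    ; acyclic = λ C isC C⊆ → acyclic C isC (λ x y c → deleteEdge-⊆ F a b x y (C⊆ x y c))
    }
    where open IsForest forest

  leaf-or-edgeless : ∀ {F} → IsForest G F → (∃ λ v → count (F v) ≡ 1) ⊎ degreeSum F ≡ 0
  leaf-or-edgeless {F} forest with Finₚ.any? (λ v → count (F v) ≟ 1)
  ... | yes leaf = inj₁ leaf
  ... | no no-leaf with Finₚ.any? (λ v → Finₚ.any? (λ u → T? (F v u)))
  ...   | no edgeless = inj₂ (trans (sum-cong-≗ (λ v → count-none (F v) (λ u vu → edgeless (v , u , vu)))) (sum-replicate-zero n))
  ...   | yes (v , u , vu) with leafless⇒cycle G F (IsForest.symmetric forest) (IsForest.irreflexive forest)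
                                  (IsForest.inG forest) (λ v leaf → no-leaf (v , leaf)) vu
  ...     | C , isC , C⊆F = ⊥-elim (IsForest.acyclic forest C isC C⊆F)

  -- Deleting the edge at a leaf v isolates v, so it lowers the support by one;
  -- and the support contains both ends of that edge.
  module DeleteLeaf {F : EdgeSet n} (forest : IsForest G F) {v u : Fin n} (leaf : count (F v) ≡ 1) (vu : T (F v u)) where
    open IsForest forest

    v≢u : v ≢ u
    v≢u refl = subst T (irreflexive v) vu

    F′ : EdgeSet n
    F′ = deleteEdge F v u

    degreeSum-F′ : degreeSum F ≡ degreeSum F′ + 2
    degreeSum-F′ = deleteEdge-degreeSum F v u symmetric vu v≢u

    v-isolated : count (F′ v) ≡ 0
    v-isolated = n≤0⇒n≡0 (+-cancelʳ-≤ 1 _ 0 (begin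
      count (F′ v) + 1                                ≤⟨ +-monoʳ-≤ (count (F′ v)) (m≤m+n 1 (ind (u == v))) ⟩
      count (F′ v) + (1 + ind (u == v))               ≡⟨ cong (λ e → count (F′ v) + (ind e + ind (u == v))) (sym (==-refl v)) ⟩
      count (F′ v) + (ind (v == v) + ind (u == v))    ≡⟨ sym (deleteEdge-degree F v u symmetric vu v≢u v) ⟩
      count (F v)                                     ≡⟨ leaf ⟩
      1                                               ∎))
      where open ≤-Reasoning

    support-F′ : support F′ + 1 ≤ support F
    support-F′ = begin
      support F′ + 1                                                    ≤⟨ +-monoˡ-≤ 1 (count-mono stillPositive) ⟩
      rest + 1                                                          ≡⟨ +-comm rest 1 ⟩
      1 + rest                                                          ≡⟨ cong (λ e → ind e + rest) (sym (to T-≡ (<⇒<ᵇ (count-≥1 (F v) u vu)))) ⟩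
      ind (0 <ᵇ count (F v)) + count (λ x → (0 <ᵇ count (F x)) ∧ not (x == v))   ≡⟨ sym (count-split _ v) ⟩
      support F                                                          ∎
      where
      open ≤-Reasoning
      rest : ℕ
      rest = count (λ x → (0 <ᵇ count (F x)) ∧ not (x == v))
      stillPositive : ∀ x → T (0 <ᵇ count (F′ x)) → T ((0 <ᵇ count (F x)) ∧ not (x == v))
      stillPositive x pos = from T-∧ (<⇒<ᵇ (<-≤-trans (<ᵇ⇒< 0 _ pos) (count-mono (deleteEdge-⊆ F v u x))) , x≢v)
        where
        x≢v : T (not (x == v))
        x≢v with x Finₚ.≟ v
        ... | yes refl = ⊥-elim (subst (λ c → T (0 <ᵇ c)) v-isolated pos)
        ... | no x≢v = tt

    support≥2 : 2 ≤ support F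
    support≥2 = count-≥2 _ v≢u (<⇒<ᵇ (count-≥1 (F v) u vu)) (<⇒<ᵇ (count-≥1 (F u) v (subst T (symmetric v u) vu)))

  -- A forest with at least one edge has more non-isolated vertices than edges:
  -- 2·|E| + 2 ≤ 2·|support|. Induction on the number of edges, deleting a leaf edge.
  forest-support : ∀ {F} → IsForest G F → degreeSum F ≡ 0 ⊎ degreeSum F + 2 ≤ 2 * support F
  forest-support {F} forest = go forest (<-wellFounded (degreeSum F))
    where
    go : ∀ {F} → IsForest G F → Acc _<_ (degreeSum F) → degreeSum F ≡ 0 ⊎ degreeSum F + 2 ≤ 2 * support F
    go {F} forest (acc smaller) with leaf-or-edgeless forest
    ... | inj₂ edgeless = inj₁ edgeless
    ... | inj₁ (v , leaf) with count-witness (F v) (≤-reflexive (sym leaf))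
    ...   | u , vu = inj₂ (extend (go (deleteEdge-forest v u forest) (smaller fewerEdges)))
      where
      open DeleteLeaf forest leaf vu
      open ≤-Reasoning
      fewerEdges : degreeSum F′ < degreeSum F
      fewerEdges = subst (degreeSum F′ <_) (sym degreeSum-F′) (m<m+n (degreeSum F′) (s≤s z≤n))
      extend : degreeSum F′ ≡ 0 ⊎ degreeSum F′ + 2 ≤ 2 * support F′ → degreeSum F + 2 ≤ 2 * support F
      extend (inj₁ edgeless′) = begin
        degreeSum F + 2   ≡⟨ cong (_+ 2) (trans degreeSum-F′ (cong (_+ 2) edgeless′)) ⟩
        2 * 2             ≤⟨ *-monoʳ-≤ 2 support≥2 ⟩
        2 * support F     ∎
      extend (inj₂ bound′) = begin
        degreeSum F + 2          ≡⟨ cong (_+ 2) degreeSum-F′ ⟩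
        degreeSum F′ + 2 + 2     ≤⟨ +-monoˡ-≤ 2 bound′ ⟩
        2 * support F′ + 2       ≡⟨ sym (*-distribˡ-+ 2 (support F′) 1) ⟩
        2 * (support F′ + 1)     ≤⟨ *-monoʳ-≤ 2 support-F′ ⟩
        2 * support F            ∎

cycle-edge : ∀ {n} {G : Graph n} {C : EdgeSet n} → IsCycle G C → ∃ λ v → ∃ λ w → T (C v w)
cycle-edge {n} {C = C} isC = v , count-witness (C v) (≤-trans (s≤s z≤n) (≤-reflexive (sym (trans (sym (degE≡count C v)) deg-v))))
  where
  open IsCycle isC
  v : Fin n
  v = proj₁ nonempty
  deg-v : degE C v ≡ 2
  deg-v = proj₂ nonempty

adj-irrefl : ∀ {n} (G : Graph n) {v w} → T (adj G v w) → v ≢ w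
adj-irrefl G {v} vw refl = subst T (irrefl G v) vw

module _ {n} {G : Graph n} (unicyclic : Unicyclic G) where
  private
    C : EdgeSet n
    C = proj₁ (proj₂ unicyclic)

    isC : IsCycle G C
    isC = proj₁ (proj₂ (proj₂ unicyclic))

    v w : Fin n
    v = proj₁ (cycle-edge isC)
    w = proj₁ (proj₂ (cycle-edge isC))

    vw-on-C : T (C v w)
    vw-on-C = proj₂ (proj₂ (cycle-edge isC))

    vw : T (adj G v w)
    vw = IsCycle.sub isC v w vw-on-C

    F : EdgeSet n
    F = deleteEdge (adj G) v w

    removeVW : degreeSum (adj G) ≡ degreeSum F + 2
    removeVW = deleteEdge-degreeSum (adj G) v w (adj-sym G) vw (adj-irrefl G vw)

    -- A cycle inside F would be a second cycle of G, as it misses the edge vw of C.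
    forest : IsForest G F
    forest = record
      { symmetric = deleteEdge-sym (adj G) v w (adj-sym G)
      ; irreflexive = deleteEdge-irrefl (adj G) v w (irrefl G)
      ; inG = deleteEdge-⊆ (adj G) v w
      ; acyclic = λ C′ isC′ C′⊆F → subst T (deleteEdge-removes (adj G) v w)
                    (C′⊆F v w (subst T (sym (proj₂ (proj₂ (proj₂ unicyclic)) C′ isC′ v w)) vw-on-C))
      }

  unicyclic-degreeSum : degreeSum (adj G) ≤ 2 * n
  unicyclic-degreeSum with forest-support forest
  ... | inj₁ edgeless = begin
        degreeSum (adj G)       ≡⟨ trans removeVW (cong (_+ 2) edgeless) ⟩
        2 * 1                   ≤⟨ *-monoʳ-≤ 2 (≤-trans (s≤s z≤n) (Finₚ.toℕ<n v)) ⟩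
        2 * n                   ∎
    where open ≤-Reasoning
  ... | inj₂ bound = begin
        degreeSum (adj G)       ≡⟨ removeVW ⟩
        degreeSum F + 2         ≤⟨ bound ⟩
        2 * support F           ≤⟨ *-monoʳ-≤ 2 (count≤ (λ x → 0 <ᵇ count (F x))) ⟩
        2 * n                   ∎
    where open ≤-Reasoning

  -- Every vertex has a neighbour: v does, and any other vertex starts a walk to v.
  unicyclic-noIsolated : ∀ x → 1 ≤ count (adj G x)
  unicyclic-noIsolated x with x Finₚ.≟ v
  ... | yes refl = count-≥1 (adj G x) w vw
  ... | no x≢v = firstStep (proj₁ unicyclic x v) x≢v
    where
    firstStep : ∀ {y z} → Reach (adj G) y z → y ≢ z → 1 ≤ count (adj G y)
    firstStep here y≢z = ⊥-elim (y≢z refl)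
    firstStep (step {v = y′} yy′ _) _ = count-≥1 (adj G _) y′ yy′

degree-class : ∀ m → 1 ≤ m → ind (m ≡ᵇ 1) + ind (m ≡ᵇ 2) + ind (3 ≤ᵇ m) ≡ 1
degree-class (suc zero) _ = refl
degree-class (suc (suc zero)) _ = refl
degree-class (suc (suc (suc m))) _ = refl

degree-excess : ∀ m → 1 ≤ m → 2 + ind (3 ≤ᵇ m) ≤ m + ind (m ≡ᵇ 1)
degree-excess (suc zero) _ = ≤-refl
degree-excess (suc (suc zero)) _ = ≤-refl
degree-excess (suc (suc (suc m))) _ = s≤s (s≤s (s≤s z≤n))

degree-excess-strict : ∀ m → 4 ≤ m → 2 + ind (3 ≤ᵇ m) < m + ind (m ≡ᵇ 1)
degree-excess-strict (suc (suc (suc (suc m)))) _ = s≤s (s≤s (s≤s (s≤s z≤n)))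
degree-excess-strict (suc zero) (s≤s ())
degree-excess-strict (suc (suc zero)) (s≤s (s≤s ()))
degree-excess-strict (suc (suc (suc zero))) (s≤s (s≤s (s≤s ())))

module DegreeSequence {n} (d : Fin n → ℕ) (positive : ∀ v → 1 ≤ d v) (handshake : ∑[ v < n ] d v ≤ 2 * n) where

  ones twos large : ℕ
  ones = count (λ v → d v ≡ᵇ 1)
  twos = count (λ v → d v ≡ᵇ 2)
  large = count (λ v → 3 ≤ᵇ d v)

  partition : n ≡ (ones + twos) + large
  partition = begin
    n                                                        ≡⟨ sym (trans (sum-const n 1) (*-identityʳ n)) ⟩
    ∑[ v < n ] 1                                             ≡⟨ sum-cong-≗ (λ v → sym (degree-class (d v) (positive v))) ⟩
    ∑[ v < n ] (ind (d v ≡ᵇ 1) + ind (d v ≡ᵇ 2) + ind (3 ≤ᵇ d v))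
      ≡⟨ ∑-distrib-+ (λ v → ind (d v ≡ᵇ 1) + ind (d v ≡ᵇ 2)) (λ v → ind (3 ≤ᵇ d v)) ⟩
    ∑[ v < n ] (ind (d v ≡ᵇ 1) + ind (d v ≡ᵇ 2)) + large    ≡⟨ cong (_+ large) (∑-distrib-+ (λ v → ind (d v ≡ᵇ 1)) _) ⟩
    (ones + twos) + large                                    ∎
    where open ≡-Reasoning

  private
    lhs : 2 * n + large ≡ ∑[ v < n ] (2 + ind (3 ≤ᵇ d v))
    lhs = sym (trans (∑-distrib-+ (λ _ → 2) (λ v → ind (3 ≤ᵇ d v))) (cong (_+ large) (trans (sum-const n 2) (*-comm n 2))))

    rhs : ∑[ v < n ] (d v + ind (d v ≡ᵇ 1)) ≤ 2 * n + ones
    rhs = ≤-trans (≤-reflexive (∑-distrib-+ d (λ v → ind (d v ≡ᵇ 1)))) (+-monoˡ-≤ ones handshake)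

  large≤ones : large ≤ ones
  large≤ones = +-cancelˡ-≤ (2 * n) large ones (begin
    2 * n + large                              ≡⟨ lhs ⟩
    ∑[ v < n ] (2 + ind (3 ≤ᵇ d v))            ≤⟨ sum-mono (λ v → degree-excess (d v) (positive v)) ⟩
    ∑[ v < n ] (d v + ind (d v ≡ᵇ 1))          ≤⟨ rhs ⟩
    2 * n + ones                               ∎)
    where open ≤-Reasoning

  tight⇒≤3 : large ≡ ones → ∀ v → d v ≤ 3
  tight⇒≤3 tight v with d v ≤? 3
  ... | yes ≤3 = ≤3
  ... | no ≰3 = ⊥-elim (<-irrefl refl (begin-strict
    2 * n + large                              ≡⟨ lhs ⟩
    ∑[ v < n ] (2 + ind (3 ≤ᵇ d v))            <⟨ sum-mono-< v (λ u → degree-excess (d u) (positive u)) (degree-excess-strict (d v) (≰⇒> ≰3)) ⟩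
    ∑[ v < n ] (d v + ind (d v ≡ᵇ 1))          ≤⟨ rhs ⟩
    2 * n + ones                               ≡⟨ cong (2 * n +_) (sym tight) ⟩
    2 * n + large                              ∎))
    where open ≤-Reasoning

count-by-code : ∀ {n k m} (p : Fin n → Bool) (ci : Fin n → Fin k) (ca cb : Fin n → Fin m)
  (Q : Fin m → Fin m → Bool) → (∀ v → T (p v) → T (Q (ca v) (cb v))) →
  (∀ u v → T (p u) → T (p v) → ci u ≡ ci v → ca u ≡ ca v → cb u ≡ cb v → u ≡ v) →
  count p ≤ k * ∑[ a < m ] ∑[ b < m ] ind (Q a b)
count-by-code {n} {k} {m} p ci ca cb Q valid determined = begin
  count p                                                            ≡⟨ count-by-key p ci ⟩
  ∑[ i < k ] count (λ u → p u ∧ ci u == i)                           ≡⟨ sum-cong-≗ (λ i → count-by-key (λ u → p u ∧ ci u == i) ca) ⟩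
  ∑[ i < k ] ∑[ a < m ] count (λ u → (p u ∧ ci u == i) ∧ ca u == a)  ≡⟨ sum-cong-≗ (λ i → sum-cong-≗ (λ a → count-by-key (λ u → (p u ∧ ci u == i) ∧ ca u == a) cb)) ⟩
  ∑[ i < k ] ∑[ a < m ] ∑[ b < m ] count (fibre i a b)               ≤⟨ sum-mono (λ i → sum-mono (λ a → sum-mono (λ b →
                                                                          count-subsingleton (fibre i a b) (Q a b) (Q-holds i a b) (fibre-unique i a b)))) ⟩
  ∑[ i < k ] ∑[ a < m ] ∑[ b < m ] ind (Q a b)                       ≡⟨ sum-const k (∑[ a < m ] ∑[ b < m ] ind (Q a b)) ⟩
  k * ∑[ a < m ] ∑[ b < m ] ind (Q a b)                              ∎
  where
  open ≤-Reasoning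
  fibre : Fin k → Fin m → Fin m → Fin n → Bool
  fibre i a b u = ((p u ∧ ci u == i) ∧ ca u == a) ∧ cb u == b

  unpack : ∀ {i a b} u → T (fibre i a b u) → T (p u) × ci u ≡ i × ca u ≡ a × cb u ≡ b
  unpack u t with to T-∧ t
  ... | t₁ , u-b with to T-∧ t₁
  ...   | t₂ , u-a with to T-∧ t₂
  ...     | pu , u-i = pu , ==⇒≡ u-i , ==⇒≡ u-a , ==⇒≡ u-b

  Q-holds : ∀ i a b u → T (fibre i a b u) → T (Q a b)
  Q-holds i a b u t with unpack u t
  ... | pu , _ , refl , refl = valid u pu

  fibre-unique : ∀ i a b u v → T (fibre i a b u) → T (fibre i a b v) → u ≡ v
  fibre-unique i a b u v tu tv with unpack u tu | unpack v tv
  ... | pu , refl , refl , refl | pv , ci≡ , ca≡ , cb≡ = determined u v pu pv (sym ci≡) (sym ca≡) (sym cb≡)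

module SmallDegree {n} (G : Graph n) where

  degree : Fin n → ℕ
  degree v = count (adj G v)

  -- A neighbour of v (v itself if there is none), the neighbours other than it, and a
  -- second neighbour (the first one if there is none).
  nb₁ : Fin n → Fin n
  nb₁ v with Finₚ.any? (λ u → T? (adj G v u))
  ... | yes (u , _) = u
  ... | no _ = v

  others : Fin n → Fin n → Bool
  others v u = adj G v u ∧ not (u == nb₁ v)

  nb₂ : Fin n → Fin n
  nb₂ v with Finₚ.any? (λ u → T? (others v u))
  ... | yes (u , _) = u
  ... | no _ = nb₁ v

  nb₁-adj : ∀ v → 1 ≤ degree v → T (adj G v (nb₁ v))
  nb₁-adj v 1≤d with Finₚ.any? (λ u → T? (adj G v u))
  ... | yes (u , vu) = vu
  ... | no none = ⊥-elim (1+n≰n (≤-trans 1≤d (≤-reflexive (count-none _ (λ u vu → none (u , vu))))))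

  nb₂-adj : ∀ v → 1 ≤ degree v → T (adj G v (nb₂ v))
  nb₂-adj v 1≤d with Finₚ.any? (λ u → T? (others v u))
  ... | yes (u , t) = proj₁ (to T-∧ t)
  ... | no _ = nb₁-adj v 1≤d

  degree-others : ∀ v → 1 ≤ degree v → degree v ≡ 1 + count (others v)
  degree-others v 1≤d = trans (count-split (adj G v) (nb₁ v)) (cong (λ e → ind e + count (others v)) (to T-≡ (nb₁-adj v 1≤d)))

  others-intro : ∀ {v u} → T (adj G v u) → u ≢ nb₁ v → T (others v u)
  others-intro vu u≢nb₁ = from T-∧ (vu , subst (T ∘ not) (sym (==-≢ u≢nb₁)) tt)

  nb-only : ∀ v → 1 ≤ degree v → degree v ≤ 2 → ∀ u → T (adj G v u) → u ≡ nb₁ v ⊎ u ≡ nb₂ v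
  nb-only v 1≤d d≤2 u vu with u Finₚ.≟ nb₁ v
  ... | yes u≡nb₁ = inj₁ u≡nb₁
  ... | no u≢nb₁ with Finₚ.any? (λ u → T? (others v u))
  ...   | no none = ⊥-elim (none (u , others-intro vu u≢nb₁))
  ...   | yes (u₂ , t₂) with u Finₚ.≟ u₂
  ...     | yes u≡u₂ = inj₂ u≡u₂
  ...     | no u≢u₂ = ⊥-elim (<-irrefl refl (begin-strict
    2                         <⟨ s≤s (count-≥2 (others v) u≢u₂ (others-intro vu u≢nb₁) t₂) ⟩
    1 + count (others v)      ≡⟨ sym (degree-others v 1≤d) ⟩
    degree v                  ≤⟨ d≤2 ⟩
    2                         ∎))
    where open ≤-Reasoning

  nb₂≡nb₁ : ∀ v → degree v ≡ 1 → nb₂ v ≡ nb₁ v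
  nb₂≡nb₁ v d≡1 with Finₚ.any? (λ u → T? (others v u))
  ... | no _ = refl
  ... | yes (u₂ , t₂) = ⊥-elim (1+n≰n (begin
    1 + 1                     ≤⟨ s≤s (count-≥1 (others v) u₂ t₂) ⟩
    1 + count (others v)      ≡⟨ sym (degree-others v (≤-reflexive (sym d≡1))) ⟩
    degree v                  ≡⟨ d≡1 ⟩
    1                         ∎))
    where open ≤-Reasoning

_≤ᶠ_ : ∀ {m} → Fin m → Fin m → Bool
a ≤ᶠ b = does (a Finₚ.≤? b)

sort : ∀ {m} → Fin m → Fin m → Fin m × Fin m
sort a b = if a ≤ᶠ b then (a , b) else (b , a)

sort-ordered : ∀ {m} (a b : Fin m) → T (proj₁ (sort a b) ≤ᶠ proj₂ (sort a b))
sort-ordered a b with a ≤ᶠ b in a≤ᶠb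
... | true = from T-≡ a≤ᶠb
... | false = from T-≡ (dec-true (b Finₚ.≤? a) (<⇒≤ (≰⇒> a≰b)))
  where
  a≰b : ¬ (toℕ a ≤ toℕ b)
  a≰b a≤b with trans (sym (dec-true (a Finₚ.≤? b) a≤b)) a≤ᶠb
  ... | ()

sort-diagonal : ∀ {m} (a : Fin m) → sort a a ≡ (a , a)
sort-diagonal a with a ≤ᶠ a
... | true = refl
... | false = refl

-- Colour j seen from a different colour i: its index among the colours other than i
-- (with an arbitrary value when i = j).
relative : ∀ {m} → Fin (suc (suc m)) → Fin (suc (suc m)) → Fin (suc m)
relative i j with i Finₚ.≟ j
... | yes _ = zero
... | no i≢j = punchOut i≢j

punchIn-relative : ∀ {m} {i j : Fin (suc (suc m))} → i ≢ j → punchIn i (relative i j) ≡ j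
punchIn-relative {i = i} {j} i≢j with i Finₚ.≟ j
... | yes i≡j = ⊥-elim (i≢j i≡j)
... | no i≢j′ = Finₚ.punchIn-punchOut i≢j′

sort-image : ∀ {m} {B : Set} (f : Fin m → B) (a b : Fin m) {j : B} →
  (j ≡ f (proj₁ (sort a b)) ⊎ j ≡ f (proj₂ (sort a b))) ⇔ (j ≡ f a ⊎ j ≡ f b)
sort-image f a b with a ≤ᶠ b
... | true = mk⇔ (λ j∈ → j∈) (λ j∈ → j∈)
... | false = mk⇔ swap swap

sortedPairs : ℕ → ℕ
sortedPairs m = ∑[ a < m ] ∑[ b < m ] ind (a ≤ᶠ b)

≤ᶠ-suc : ∀ {m} (a b : Fin m) → (suc a ≤ᶠ suc b) ≡ (a ≤ᶠ b)
≤ᶠ-suc zero b = refl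
≤ᶠ-suc (suc a) b = refl

sortedPairs-suc : ∀ m → sortedPairs (suc m) ≡ suc m + sortedPairs m
sortedPairs-suc m = cong₂ _+_ (trans (sum-const (suc m) 1) (*-identityʳ (suc m)))
  (sum-cong-≗ {x = λ a → ∑[ b < m ] ind (suc a ≤ᶠ suc b)} (λ a → sum-cong-≗ (λ b → cong ind (≤ᶠ-suc a b))))

sortedPairs-closed : ∀ m → 2 * sortedPairs m ≡ m * suc m
sortedPairs-closed zero = refl
sortedPairs-closed (suc m) = begin
  2 * sortedPairs (suc m)           ≡⟨ cong (2 *_) (sortedPairs-suc m) ⟩
  2 * (suc m + sortedPairs m)       ≡⟨ *-distribˡ-+ 2 (suc m) (sortedPairs m) ⟩
  2 * suc m + 2 * sortedPairs m     ≡⟨ cong (2 * suc m +_) (sortedPairs-closed m) ⟩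
  2 * suc m + m * suc m             ≡⟨ factor m ⟩
  suc m * suc (suc m)               ∎
  where
  open ≡-Reasoning
  factor : ∀ m → 2 * suc m + m * suc m ≡ suc m * suc (suc m)
  factor = solve-∀

diagonalPairs : ∀ m → ∑[ a < m ] ∑[ b < m ] ind (a == b) ≡ m
diagonalPairs m = trans (sum-cong-≗ {x = λ a → ∑[ b < m ] ind (a == b)} {y = λ _ → 1} sum-single) (trans (sum-const m 1) (*-identityʳ m))

a₂-sortedPairs : ∀ m → a₂ (2 + m) ≡ (2 + m) * sortedPairs m
a₂-sortedPairs m = trans (cong (_/ 2) regroup) (m*n/n≡m ((2 + m) * sortedPairs m) 2)
  where
  open ≡-Reasoning
  regroup : (2 + m) * (1 + m) * m ≡ (2 + m) * sortedPairs m * 2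
  regroup = begin
    (2 + m) * (1 + m) * m            ≡⟨ reassoc (2 + m) m ⟩
    (2 + m) * (m * (1 + m))          ≡⟨ cong ((2 + m) *_) (sym (sortedPairs-closed m)) ⟩
    (2 + m) * (2 * sortedPairs m)    ≡⟨ swap2 (2 + m) (sortedPairs m) ⟩
    (2 + m) * sortedPairs m * 2      ∎
    where
    reassoc : ∀ k m → k * (1 + m) * m ≡ k * (m * (1 + m))
    reassoc = solve-∀
    swap2 : ∀ k p → k * (2 * p) ≡ k * p * 2
    swap2 = solve-∀

small-total : ∀ m → (2 + m) * sortedPairs (1 + m) ≡ a₁ (2 + m) + a₂ (2 + m)
small-total m = begin
  (2 + m) * sortedPairs (1 + m)                       ≡⟨ cong ((2 + m) *_) (sortedPairs-suc m) ⟩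
  (2 + m) * ((1 + m) + sortedPairs m)                 ≡⟨ *-distribˡ-+ (2 + m) (1 + m) (sortedPairs m) ⟩
  (2 + m) * (1 + m) + (2 + m) * sortedPairs m         ≡⟨ cong (a₁ (2 + m) +_) (sym (a₂-sortedPairs m)) ⟩
  a₁ (2 + m) + a₂ (2 + m)                             ∎
  where open ≡-Reasoning

closedForm : ∀ k → 2 * a₁ k + a₂ k ≡ (k ^ 3 + k ^ 2 ∸ 2 * k) / 2
closedForm zero = refl
closedForm (suc zero) = refl
closedForm (suc (suc m)) = sym (begin
  (k ^ 3 + k ^ 2 ∸ 2 * k) / 2              ≡⟨ cong (λ x → (x ∸ 2 * k) / 2) cubic ⟩
  (2 * k + total * 2 ∸ 2 * k) / 2          ≡⟨ cong (_/ 2) (m+n∸m≡n (2 * k) (total * 2)) ⟩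
  (total * 2) / 2                          ≡⟨ m*n/n≡m total 2 ⟩
  total                                    ∎)
  where
  open ≡-Reasoning
  k total : ℕ
  k = 2 + m
  total = 2 * a₁ k + a₂ k
  poly : ∀ m → (2 + m) * ((2 + m) * ((2 + m) * 1)) + (2 + m) * ((2 + m) * 1) ≡ 2 * (2 + m) + 4 * ((2 + m) * (1 + m)) + (2 + m) * (m * (1 + m))
  poly = solve-∀
  regroup : ∀ k a p → 2 * k + 4 * a + k * (2 * p) ≡ 2 * k + (2 * a + k * p) * 2
  regroup = solve-∀
  cubic : k ^ 3 + k ^ 2 ≡ 2 * k + total * 2
  cubic = begin
    k ^ 3 + k ^ 2                                             ≡⟨ poly m ⟩
    2 * k + 4 * a₁ k + k * (m * (1 + m))                      ≡⟨ cong (λ x → 2 * k + 4 * a₁ k + k * x) (sym (sortedPairs-closed m)) ⟩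
    2 * k + 4 * a₁ k + k * (2 * sortedPairs m)                ≡⟨ regroup k (a₁ k) (sortedPairs m) ⟩
    2 * k + (2 * a₁ k + k * sortedPairs m) * 2                ≡⟨ cong (λ x → 2 * k + (2 * a₁ k + x) * 2) (sym (a₂-sortedPairs m)) ⟩
    2 * k + total * 2                                         ∎

-- In a neighbour-locating colouring c with k = m + 2 colours, a vertex v of degree 1 or 2 is
-- determined by its colour and the sorted pair of its neighbours' colours, both recorded
-- relative to c v (so in Fin (m + 1)). A vertex of degree 1 has a repeated pair.
module NeighbourLocating {n m} (G : Graph n) (c : Fin n → Fin (suc (suc m))) (nl : IsNLColoring G c) where
  open IsNLColoring nl
  open SmallDegree G

  small : Fin n → Bool
  small v = (degree v ≡ᵇ 1) ∨ (degree v ≡ᵇ 2)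

  small-bounds : ∀ {v} → T (small v) → 1 ≤ degree v × degree v ≤ 2
  small-bounds {v} s with to T-∨ s
  ... | inj₁ d≡1 = ≤-reflexive (sym (≡ᵇ⇒≡ _ 1 d≡1)) , ≤-trans (≤-reflexive (≡ᵇ⇒≡ _ 1 d≡1)) (s≤s z≤n)
  ... | inj₂ d≡2 = ≤-trans (s≤s z≤n) (≤-reflexive (sym (≡ᵇ⇒≡ _ 2 d≡2))) , ≤-reflexive (≡ᵇ⇒≡ _ 2 d≡2)

  rel₁ rel₂ : Fin n → Fin (suc m)
  rel₁ v = relative (c v) (c (nb₁ v))
  rel₂ v = relative (c v) (c (nb₂ v))

  code : Fin n → Fin (suc m) × Fin (suc m)
  code v = sort (rel₁ v) (rel₂ v)

  nbColours : ∀ {v} → T (small v) → ∀ j →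
    NbColor G c v j ⇔ (j ≡ punchIn (c v) (proj₁ (code v)) ⊎ j ≡ punchIn (c v) (proj₂ (code v)))
  nbColours {v} s j = mk⇔ (λ nbj → from sorted (relativise (neighbours nbj))) (λ j∈ → reach (unrelativise (to sorted j∈)))
    where
    1≤d : 1 ≤ degree v
    1≤d = proj₁ (small-bounds s)
    sorted : (j ≡ punchIn (c v) (proj₁ (code v)) ⊎ j ≡ punchIn (c v) (proj₂ (code v))) ⇔
             (j ≡ punchIn (c v) (rel₁ v) ⊎ j ≡ punchIn (c v) (rel₂ v))
    sorted = sort-image (punchIn (c v)) (rel₁ v) (rel₂ v)
    r₁ : punchIn (c v) (rel₁ v) ≡ c (nb₁ v)
    r₁ = punchIn-relative (proper v (nb₁ v) (nb₁-adj v 1≤d))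
    r₂ : punchIn (c v) (rel₂ v) ≡ c (nb₂ v)
    r₂ = punchIn-relative (proper v (nb₂ v) (nb₂-adj v 1≤d))
    neighbours : NbColor G c v j → j ≡ c (nb₁ v) ⊎ j ≡ c (nb₂ v)
    neighbours (u , vu , cu≡j) with nb-only v 1≤d (proj₂ (small-bounds s)) u vu
    ... | inj₁ refl = inj₁ (sym cu≡j)
    ... | inj₂ refl = inj₂ (sym cu≡j)
    reach : j ≡ c (nb₁ v) ⊎ j ≡ c (nb₂ v) → NbColor G c v j
    reach (inj₁ j≡) = nb₁ v , nb₁-adj v 1≤d , sym j≡
    reach (inj₂ j≡) = nb₂ v , nb₂-adj v 1≤d , sym j≡
    relativise : j ≡ c (nb₁ v) ⊎ j ≡ c (nb₂ v) → j ≡ punchIn (c v) (rel₁ v) ⊎ j ≡ punchIn (c v) (rel₂ v)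
    relativise (inj₁ j≡) = inj₁ (trans j≡ (sym r₁))
    relativise (inj₂ j≡) = inj₂ (trans j≡ (sym r₂))
    unrelativise : j ≡ punchIn (c v) (rel₁ v) ⊎ j ≡ punchIn (c v) (rel₂ v) → j ≡ c (nb₁ v) ⊎ j ≡ c (nb₂ v)
    unrelativise (inj₁ j≡) = inj₁ (trans j≡ r₁)
    unrelativise (inj₂ j≡) = inj₂ (trans j≡ r₂)

  determined : ∀ u v → T (small u) → T (small v) → c u ≡ c v →
    proj₁ (code u) ≡ proj₁ (code v) → proj₂ (code u) ≡ proj₂ (code v) → u ≡ v
  determined u v su sv cu≡cv a≡ b≡ with u Finₚ.≟ v
  ... | yes u≡v = u≡v
  ... | no u≢v = ⊥-elim (locating u v u≢v cu≡cv λ j →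
          mk⇔ (λ nbj → from (nbColours sv j) (same (to (nbColours su j) nbj)))
              (λ nbj → from (nbColours su j) (same′ (to (nbColours sv j) nbj))))
    where
    same : ∀ {j} → j ≡ punchIn (c u) (proj₁ (code u)) ⊎ j ≡ punchIn (c u) (proj₂ (code u)) →
                    j ≡ punchIn (c v) (proj₁ (code v)) ⊎ j ≡ punchIn (c v) (proj₂ (code v))
    same j∈ rewrite cu≡cv | a≡ | b≡ = j∈
    same′ : ∀ {j} → j ≡ punchIn (c v) (proj₁ (code v)) ⊎ j ≡ punchIn (c v) (proj₂ (code v)) →
                     j ≡ punchIn (c u) (proj₁ (code u)) ⊎ j ≡ punchIn (c u) (proj₂ (code u))
    same′ j∈ rewrite cu≡cv | a≡ | b≡ = j∈

  -- At most k · #{a ≤ b in Fin (m + 1)} = a₁(k) + a₂(k) vertices have degree 1 or 2 …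
  degree12-bound : count (λ v → degree v ≡ᵇ 1) + count (λ v → degree v ≡ᵇ 2) ≤ a₁ (2 + m) + a₂ (2 + m)
  degree12-bound = subst₂ _≤_ (count-∨ (λ v → degree v ≡ᵇ 1) (λ v → degree v ≡ᵇ 2) disjoint) (small-total m)
    (count-by-code small c (proj₁ ∘ code) (proj₂ ∘ code) _≤ᶠ_
      (λ v _ → sort-ordered (rel₁ v) (rel₂ v)) determined)
    where
    disjoint : ∀ v → T (degree v ≡ᵇ 1) → ¬ T (degree v ≡ᵇ 2)
    disjoint v d≡1 d≡2 = 1+n≢n (trans (sym (≡ᵇ⇒≡ (degree v) 2 d≡2)) (≡ᵇ⇒≡ (degree v) 1 d≡1))

  -- … and at most k · (m + 1) = a₁(k) have degree 1, their code being a repeated pair.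
  degree1-bound : count (λ v → degree v ≡ᵇ 1) ≤ a₁ (2 + m)
  degree1-bound = subst (count (λ v → degree v ≡ᵇ 1) ≤_) (cong ((2 + m) *_) (diagonalPairs (1 + m)))
    (count-by-code (λ v → degree v ≡ᵇ 1) c (proj₁ ∘ code) (proj₂ ∘ code) _==_ repeated
      (λ u v lu lv → determined u v (from T-∨ (inj₁ lu)) (from T-∨ (inj₁ lv))))
    where
    repeated : ∀ v → T (degree v ≡ᵇ 1) → T (proj₁ (code v) == proj₂ (code v))
    repeated v leaf rewrite nb₂≡nb₁ v (≡ᵇ⇒≡ _ 1 leaf) | sort-diagonal (rel₁ v) = T-==-refl (rel₁ v)

twice-plus : ∀ a b → (a + b) + a ≡ 2 * a + b
twice-plus = solve-∀

squeeze-≤ : ∀ {x₁ x₂ x₃ A₁ A₂} → x₁ + x₂ ≤ A₁ + A₂ → x₃ ≤ x₁ → x₁ ≤ A₁ → (x₁ + x₂) + x₃ ≤ 2 * A₁ + A₂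
squeeze-≤ {A₁ = A₁} {A₂} x₁₂≤ x₃≤x₁ x₁≤ = ≤-trans (+-mono-≤ x₁₂≤ (≤-trans x₃≤x₁ x₁≤)) (≤-reflexive (twice-plus A₁ A₂))

squeeze-≡ : ∀ {x₁ x₂ x₃ A₁ A₂} → x₁ + x₂ ≤ A₁ + A₂ → x₃ ≤ x₁ → x₁ ≤ A₁ →
  (x₁ + x₂) + x₃ ≡ 2 * A₁ + A₂ → x₁ ≡ A₁ × x₂ ≡ A₂ × x₃ ≡ A₁
squeeze-≡ {x₁} {x₂} {x₃} {A₁} {A₂} x₁₂≤ x₃≤x₁ x₁≤ total = x₁≡ , x₂≡ , x₃≡
  where
  open ≤-Reasoning
  total′ : (x₁ + x₂) + x₃ ≡ (A₁ + A₂) + A₁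
  total′ = trans total (sym (twice-plus A₁ A₂))
  x₁₂≡ : x₁ + x₂ ≡ A₁ + A₂
  x₁₂≡ = ≤-antisym x₁₂≤ (+-cancelʳ-≤ A₁ _ _ (begin
    (A₁ + A₂) + A₁     ≡⟨ sym total′ ⟩
    (x₁ + x₂) + x₃     ≤⟨ +-monoʳ-≤ (x₁ + x₂) (≤-trans x₃≤x₁ x₁≤) ⟩
    (x₁ + x₂) + A₁     ∎))
  x₃≡ : x₃ ≡ A₁
  x₃≡ = +-cancelˡ-≡ (A₁ + A₂) x₃ A₁ (trans (cong (_+ x₃) (sym x₁₂≡)) total′)
  x₁≡ : x₁ ≡ A₁
  x₁≡ = ≤-antisym x₁≤ (subst (_≤ x₁) x₃≡ x₃≤x₁)
  x₂≡ : x₂ ≡ A₂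
  x₂≡ = +-cancelˡ-≡ A₁ x₂ A₂ (trans (cong (_+ x₂) (sym x₁≡)) x₁₂≡)

numDeg≡count : ∀ {n} (G : Graph n) d → numDeg G d ≡ count (λ v → count (adj G v) ≡ᵇ d)
numDeg≡count {n} G d = trans (length-filter (λ i → i)) (count-cong (λ v → cong (_≡ᵇ d) (degE≡count (adj G) v)))
  where
  length-filter : ∀ {m} (h : Fin m → Fin n) →
    length (filter (λ v → deg G v ≟ d) (tabulate h)) ≡ ∑[ i < m ] ind (deg G (h i) ≡ᵇ d)
  length-filter {zero} h = refl
  length-filter {suc m} h with deg G (h zero) ≡ᵇ d
  ... | true = cong suc (length-filter (h ∘ suc))
  ... | false = length-filter (h ∘ suc)

module GraphDegrees {n} (G : Graph n) (positive : ∀ v → 1 ≤ count (adj G v)) (handshake : degreeSum (adj G) ≤ 2 * n) where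
  open DegreeSequence (λ v → count (adj G v)) positive handshake public

  numDeg3 : (∀ v → count (adj G v) ≤ 3) → numDeg G 3 ≡ large
  numDeg3 ≤3 = trans (numDeg≡count G 3) (count-cong (λ v → exactly3 (≤3 v)))
    where
    exactly3 : ∀ {d} → d ≤ 3 → (d ≡ᵇ 3) ≡ (3 ≤ᵇ d)
    exactly3 {zero} _ = refl
    exactly3 {suc zero} _ = refl
    exactly3 {suc (suc zero)} _ = refl
    exactly3 {suc (suc (suc zero))} _ = refl
    exactly3 {suc (suc (suc (suc d)))} (s≤s (s≤s (s≤s ())))

  maxDegree3 : (∀ v → count (adj G v) ≤ 3) → 1 ≤ numDeg G 3 → MaxDegree G 3
  maxDegree3 ≤3 some with count-witness (λ v → count (adj G v) ≡ᵇ 3) (subst (1 ≤_) (numDeg≡count G 3) some)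
  ... | v , deg-v = (λ u → subst (_≤ 3) (sym (degE≡count (adj G) u)) (≤3 u)) ,
                    v , trans (degE≡count (adj G) v) (≡ᵇ⇒≡ _ 3 deg-v)

  extremal-degrees : ∀ {A B} → 1 ≤ A → ones ≡ A → twos ≡ B → large ≡ A →
    MaxDegree G 3 × numDeg G 1 ≡ A × numDeg G 2 ≡ B × numDeg G 3 ≡ A
  extremal-degrees {A} 1≤A ones≡ twos≡ large≡ =
    maxDegree3 ≤3 (subst (1 ≤_) (sym numDeg3≡) 1≤A) ,
    trans (numDeg≡count G 1) ones≡ , trans (numDeg≡count G 2) twos≡ , numDeg3≡
    where
    ≤3 : ∀ v → count (adj G v) ≤ 3
    ≤3 = tight⇒≤3 (trans large≡ (sym ones≡))
    numDeg3≡ : numDeg G 3 ≡ A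
    numDeg3≡ = trans (numDeg3 ≤3) large≡

theorem21 : ∀ (n : ℕ) (G : Graph n) (k : ℕ) → Unicyclic G → χNL≡ G k → 3 ≤ k →
    (n ≤ 2 * a₁ k + a₂ k)
    × (2 * a₁ k + a₂ k ≡ (k ^ 3 + k ^ 2 ∸ 2 * k) / 2)
    × (n ≡ 2 * a₁ k + a₂ k →
        MaxDegree G 3
        × numDeg G 1 ≡ a₁ k
        × numDeg G 2 ≡ a₂ k
        × numDeg G 3 ≡ a₁ k)
theorem21 n G (suc zero) _ _ (s≤s ())
theorem21 n G (suc (suc zero)) _ _ (s≤s (s≤s ()))
theorem21 n G (suc (suc (suc r))) unicyclic ((c , nl) , _) _ =
  subst (_≤ 2 * a₁ k + a₂ k) (sym partition) (squeeze-≤ {ones} {twos} {large} {a₁ k} {a₂ k} small≤ large≤ones ones≤) ,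
  closedForm k ,
  λ tight → extremal (squeeze-≡ {ones} {twos} {large} {a₁ k} {a₂ k} small≤ large≤ones ones≤ (trans (sym partition) tight))
  where
  k : ℕ
  k = 3 + r
  open GraphDegrees G (unicyclic-noIsolated unicyclic) (unicyclic-degreeSum unicyclic)
  open NeighbourLocating G c nl renaming (degree12-bound to small≤; degree1-bound to ones≤)
  extremal : ones ≡ a₁ k × twos ≡ a₂ k × large ≡ a₁ k →
    MaxDegree G 3 × numDeg G 1 ≡ a₁ k × numDeg G 2 ≡ a₂ k × numDeg G 3 ≡ a₁ k
  extremal (ones≡ , twos≡ , large≡) = extremal-degrees (s≤s z≤n) ones≡ twos≡ large≡
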